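{- Suppose that $\mathbf{w}\in\{0,1,2\}^\omega$ contains no factor of exponent $\ge 5/2$, and that $\mathbf{w}=g(\mathbf{u})$ for some $\mathbf{u}\in\{0,1,2\}^\omega$, where $g=[a,b,c]$ with $a,b,c\in\{0,1,2\}^+$ such that: (1) $b$ is a prefix of $a$, which is a prefix of $c$; (2) $|b|\ge|c|/2$; (3) $b$ and $c$ have a common suffix $s$ with $|s|\ge|b|/2$. Then for each positive integer $n$, a final segment of $\mathbf{w}$ has the form $g(\gamma^{2n}(\mathbf{v}))$ for some $\mathbf{v}\in\{0,1,2\}^\omega$. Consequently $L(\mathbf{w})\supseteq L(g(\mathbf{G}))$.
   Context: $g=[a,b,c]$ denotes the morphism with $g(0)=a,g(1)=b,g(2)=c$. $\gamma=[01,2,02]$ and $\mathbf{G}=\gamma^\omega(0)$ is its fixed point. $L(\mathbf{x})$ is the set of finite factors of an infinite word $\mathbf{x}$. The exponent of a finite nonempty word with smallest period $p$ is its length divided by $p$. A final segment is an infinite suffix. -}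

module Defs where

open import Data.Nat using (ℕ; zero; suc; _+_; _*_; _≤_; _<_)
open import Data.Fin using (Fin; zero; suc)
open import Data.List using (List; []; _∷_; _++_; length; concatMap)
open import Data.Product using (Σ; ∃; _×_; _,_)
open import Relation.Binary.PropositionalEquality using (_≡_)
open import Function using (_∘_)

Letter : Set
Letter = Fin 3

Word : Set
Word = List Letter

InfWord : Set
InfWord = ℕ → Letter

Morphism : Set
Morphism = Letter → Word

[_,_,_] : Word → Word → Word → Morphism
[ a , b , c ] zero = a
[ a , b , c ] (suc zero) = b
[ a , b , c ] (suc (suc zero)) = c

applyW : Morphism → Word → Word
applyW g = concatMap g

_^^_ : Morphism → ℕ → Morphism
(g ^^ zero) x = x ∷ []
(g ^^ suc k) x = applyW g ((g ^^ k) x)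

0' 1' 2' : Letter
0' = zero
1' = suc zero
2' = suc (suc zero)

γ : Morphism
γ = [ 0' ∷ 1' ∷ [] , 2' ∷ [] , 0' ∷ 2' ∷ [] ]

nth : Word → ℕ → Letter → Letter
nth [] i d = d
nth (x ∷ xs) zero d = x
nth (x ∷ xs) (suc i) d = nth xs i d

prefixOf : InfWord → ℕ → Word
prefixOf u zero = []
prefixOf u (suc n) = u 0 ∷ prefixOf (u ∘ suc) n

-- image g(u) of an infinite word under a morphism with nonempty images:
-- its i-th letter is the i-th letter of g(u[0..i]) (which has length ≥ i+1
-- whenever all images of g are nonempty).
applyInf : Morphism → InfWord → InfWord
applyInf g u i = nth (applyW g (prefixOf u (suc i))) i zero

-- fixed point G = γ^ω(0): its i-th letter is the i-th letter of γ^(i+1)(0)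
-- (|γ^k(0)| ≥ k+1, and γ^k(0) is a prefix of γ^(k+1)(0)).
G : InfWord
G i = nth ((γ ^^ suc i) 0') i zero

_≐_ : InfWord → InfWord → Set
u ≐ v = ∀ i → u i ≡ v i

suffixFrom : ℕ → InfWord → InfWord
suffixFrom k w i = w (k + i)

Factor : Word → InfWord → Set
Factor x w = ∃ λ k → prefixOf (suffixFrom k w) (length x) ≡ x

IsPrefix : Word → Word → Set
IsPrefix x y = ∃ λ z → x ++ z ≡ y

IsSuffix : Word → Word → Set
IsSuffix x y = ∃ λ z → z ++ x ≡ y

NonEmpty : Word → Set
NonEmpty x = ∃ λ y → ∃ λ ys → x ≡ y ∷ ys

at : Word → ℕ → Letter
at x i = nth x i zero

HasPeriod : Word → ℕ → Set
HasPeriod x p = (0 < p) × (∀ i → i + p < length x → at x i ≡ at x (i + p))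

SmallestPeriod : Word → ℕ → Set
SmallestPeriod x p = HasPeriod x p × (∀ q → HasPeriod x q → p ≤ q)

ExponentAtLeast5/2 : Word → Set
ExponentAtLeast5/2 x = NonEmpty x × ∃ λ p → SmallestPeriod x p × (5 * p ≤ 2 * length x)

Avoids5/2Powers : InfWord → Set
Avoids5/2Powers w = ∀ x → Factor x w → ExponentAtLeast5/2 x → Data.Empty.⊥
  where import Data.Empty

{-# OPTIONS --safe #-}
module Submission where

open import Defs
open import Data.Nat using (ℕ; zero; suc; _+_; _*_; _≤_; _<_; z≤n; s≤s)
open import Data.Nat.Properties
open import Data.Nat.Induction using (<-rec)
open import Data.Nat.Tactic.RingSolver using (solve-∀)
open import Data.Fin using (zero; suc)
import Data.Fin.Properties as Fin
open import Data.List using ([]; _∷_; _++_; length)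
open import Data.List.Properties
  using ( length-++; length-++-≤ˡ; length-++-≤ʳ; length-++-comm; ++-assoc; ++-identityʳ; ++-monoid
        ; concatMap-++; concatMap-cong; concatMap-pure)
open import Data.List.Effectful using (module MonadProperties)
open import Data.Product using (Σ; ∃; _×_; _,_; proj₁; proj₂)
open import Data.Empty using (⊥; ⊥-elim)
open import Relation.Nullary using (¬_; Dec; yes; no)
open import Relation.Nullary.Decidable using (map′; _×-dec_; _→-dec_)
open import Relation.Binary.PropositionalEquality hiding ([_])
open import Function using (_∘_)
open import Tactic.MonoidSolver using (solve)

-- Every g-image begins with b, the images of 0 and 2 begin with a, and b = y s, c = z s end with
-- the common suffix s. So a factor xx, 21 or 0101 of u would put g(x)g(x)b, (sy)(sy)s or (ab)(ab)a
-- into w, and by (2), (3) and |b| ≤ |a| each of these has exponent at least 5/2. A word avoiding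
-- xx, 21 and 0101 has a final segment that cuts into the blocks γ²(0) = 012, γ²(1) = 02 and
-- γ²(2) = 0102, so w has a final segment g(γ²(v)).
-- Now gγ²(x) = p(x) c with p = [ab, a, aba], and h = [cab, ca, caba] is the conjugate h(x) = c p(x);
-- thus c gγ²(X) = h(X) c, so h(v₁v₂…) is a final segment of gγ²(v) and gγ²(y) one of h(y). As h
-- again satisfies (1)-(3), induction on n gives final segments g(γ²ⁿ(v)) of w. Finally γ²(x) begins
-- with 0, so g(γ²ⁿ⁺²(v)) begins with g(γ²ⁿ(0)), a prefix of g(G) of length at least n; hence every
-- factor of g(G) is a factor of w.

IsPrefix-refl : ∀ X → IsPrefix X X
IsPrefix-refl X = [] , ++-identityʳ X

IsPrefix-trans : ∀ {X Y Z} → IsPrefix X Y → IsPrefix Y Z → IsPrefix X Z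
IsPrefix-trans {X} (R , refl) (S , refl) = R ++ S , sym (++-assoc X R S)

IsPrefix-++ˡ : ∀ {X Y} P → IsPrefix X Y → IsPrefix (P ++ X) (P ++ Y)
IsPrefix-++ˡ {X} P (R , refl) = R , ++-assoc P X R

IsPrefix-++ʳ : ∀ {X Y} Z → IsPrefix X Y → IsPrefix X (Y ++ Z)
IsPrefix-++ʳ {X} Z (R , refl) = R ++ Z , sym (++-assoc X R Z)

IsPrefix-length : ∀ {X Y} → IsPrefix X Y → length X ≤ length Y
IsPrefix-length {X} (R , refl) = length-++-≤ˡ X

IsSuffix-++ : ∀ {s X} P Q → IsSuffix s X → IsSuffix (s ++ Q) (P ++ X ++ Q)
IsSuffix-++ {s} P Q (R , refl) = P ++ R , solve (++-monoid Letter)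

NonEmpty⇒0<length : ∀ {X} → NonEmpty X → 0 < length X
NonEmpty⇒0<length (_ , _ , refl) = s≤s z≤n

NonEmpty-++ : ∀ {X} Y → NonEmpty X → NonEmpty (X ++ Y)
NonEmpty-++ Y (x , X , refl) = x , X ++ Y , refl

at-++ˡ : ∀ X Y {i} → i < length X → at (X ++ Y) i ≡ at X i
at-++ˡ (x ∷ X) Y {zero} _ = refl
at-++ˡ (x ∷ X) Y {suc i} (s≤s i<∣X∣) = at-++ˡ X Y i<∣X∣

at-++ʳ : ∀ X Y i → at (X ++ Y) (length X + i) ≡ at Y i
at-++ʳ [] Y i = refl
at-++ʳ (x ∷ X) Y i = at-++ʳ X Y i

at-IsPrefix : ∀ {X Y i} → IsPrefix X Y → i < length X → at X i ≡ at Y i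
at-IsPrefix {X} (R , refl) i<∣X∣ = sym (at-++ˡ X R i<∣X∣)

record NonErasing (f : Morphism) : Set where
  constructor nonErasing
  field nonEmpty-image : ∀ x → 0 < length (f x)
open NonErasing

length-applyW : ∀ {f} → NonErasing f → ∀ X → length X ≤ length (applyW f X)
length-applyW ne [] = z≤n
length-applyW {f} ne (x ∷ X) = begin
  suc (length X)                      ≤⟨ +-mono-≤ (nonEmpty-image ne x) (length-applyW ne X) ⟩
  length (f x) + length (applyW f X)  ≡⟨ length-++ (f x) ⟨
  length (applyW f (x ∷ X))           ∎
  where open ≤-Reasoning

applyW-IsPrefix : ∀ f {X Y} → IsPrefix X Y → IsPrefix (applyW f X) (applyW f Y)
applyW-IsPrefix f {X} (R , refl) = applyW f R , sym (concatMap-++ f X R)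

applyW-∘ : ∀ f k X → applyW (applyW f ∘ k) X ≡ applyW f (applyW k X)
applyW-∘ f k X = MonadProperties.associative X k f

NonErasing-∘ : ∀ {f k} → NonErasing f → NonErasing k → NonErasing (applyW f ∘ k)
NonErasing-∘ {k = k} nf nk = nonErasing λ x → ≤-trans (nonEmpty-image nk x) (length-applyW nf (k x))

NonErasing-^^ : ∀ {f} → NonErasing f → ∀ n → NonErasing (f ^^ n)
NonErasing-^^ nf zero = nonErasing λ _ → s≤s z≤n
NonErasing-^^ nf (suc n) = NonErasing-∘ nf (NonErasing-^^ nf n)

^^-+ : ∀ f m n x → (f ^^ (m + n)) x ≡ applyW (f ^^ m) ((f ^^ n) x)
^^-+ f zero n x = sym (concatMap-pure ((f ^^ n) x))
^^-+ f (suc m) n x = begin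
  applyW f ((f ^^ (m + n)) x)              ≡⟨ cong (applyW f) (^^-+ f m n x) ⟩
  applyW f (applyW (f ^^ m) ((f ^^ n) x))  ≡⟨ applyW-∘ f (f ^^ m) ((f ^^ n) x) ⟨
  applyW (f ^^ suc m) ((f ^^ n) x)         ∎
  where open ≡-Reasoning

IsPrefix-applyW-prefixOf-suc : ∀ {f c} → (∀ x → IsPrefix c (f x)) → ∀ y n →
  IsPrefix (applyW f (prefixOf y n) ++ c) (applyW f (prefixOf y (suc n)))
IsPrefix-applyW-prefixOf-suc c≼f y zero = IsPrefix-++ʳ [] (c≼f (y 0))
IsPrefix-applyW-prefixOf-suc {f} {c} c≼f y (suc n) =
  subst (λ X → IsPrefix X _) (sym (++-assoc (f (y 0)) _ c))
    (IsPrefix-++ˡ (f (y 0)) (IsPrefix-applyW-prefixOf-suc c≼f (y ∘ suc) n))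

infix 4 _⊑_

-- Factor x w unfolds to ∃ λ k → x ⊑ suffixFrom k w.
_⊑_ : Word → InfWord → Set
X ⊑ u = prefixOf u (length X) ≡ X

≐-sym : ∀ {u v} → u ≐ v → v ≐ u
≐-sym u≐v i = sym (u≐v i)

≐-trans : ∀ {u v w} → u ≐ v → v ≐ w → u ≐ w
≐-trans u≐v v≐w i = trans (u≐v i) (v≐w i)

length-prefixOf : ∀ u n → length (prefixOf u n) ≡ n
length-prefixOf u zero = refl
length-prefixOf u (suc n) = cong suc (length-prefixOf (u ∘ suc) n)

at-prefixOf : ∀ u {n i} → i < n → at (prefixOf u n) i ≡ u i
at-prefixOf u {suc n} {zero} _ = refl
at-prefixOf u {suc n} {suc i} (s≤s i<n) = at-prefixOf (u ∘ suc) i<n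

prefixOf-+ : ∀ u m n → prefixOf u (m + n) ≡ prefixOf u m ++ prefixOf (suffixFrom m u) n
prefixOf-+ u zero n = refl
prefixOf-+ u (suc m) n = cong (u 0 ∷_) (prefixOf-+ (u ∘ suc) m n)

prefixOf-IsPrefix : ∀ u {m n} → m ≤ n → IsPrefix (prefixOf u m) (prefixOf u n)
prefixOf-IsPrefix u {n = n} z≤n = prefixOf u n , refl
prefixOf-IsPrefix u (s≤s m≤n) =
  let R , eq = prefixOf-IsPrefix (u ∘ suc) m≤n in R , cong (u 0 ∷_) eq

prefixOf-⊑ : ∀ u n → prefixOf u n ⊑ u
prefixOf-⊑ u n = cong (prefixOf u) (length-prefixOf u n)

⊑-at : ∀ {X u i} → X ⊑ u → i < length X → at X i ≡ u i
⊑-at {u = u} {i} X⊑u i<∣X∣ = trans (cong (λ Y → at Y i) (sym X⊑u)) (at-prefixOf u i<∣X∣)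

at-⊑ : ∀ {X u} → (∀ {i} → i < length X → at X i ≡ u i) → X ⊑ u
at-⊑ {[]} agree = refl
at-⊑ {x ∷ X} agree = cong₂ _∷_ (sym (agree (s≤s z≤n))) (at-⊑ λ i<∣X∣ → agree (s≤s i<∣X∣))

⊑-cong : ∀ {X u v} → u ≐ v → X ⊑ u → X ⊑ v
⊑-cong u≐v X⊑u = at-⊑ λ i<∣X∣ → trans (⊑-at X⊑u i<∣X∣) (u≐v _)

⊑-IsPrefix : ∀ {X Y u} → IsPrefix X Y → Y ⊑ u → X ⊑ u
⊑-IsPrefix X≼Y Y⊑u = at-⊑ λ i<∣X∣ →
  trans (at-IsPrefix X≼Y i<∣X∣) (⊑-at Y⊑u (<-≤-trans i<∣X∣ (IsPrefix-length X≼Y)))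

⊑-++ : ∀ {X Y u} → X ⊑ u → Y ⊑ suffixFrom (length X) u → X ++ Y ⊑ u
⊑-++ {X} {Y} {u} X⊑u Y⊑ = begin
  prefixOf u (length (X ++ Y))          ≡⟨ cong (prefixOf u) (length-++ X) ⟩
  prefixOf u (length X + length Y)      ≡⟨ prefixOf-+ u (length X) (length Y) ⟩
  prefixOf u (length X) ++ prefixOf (suffixFrom (length X) u) (length Y)
                                        ≡⟨ cong₂ _++_ X⊑u Y⊑ ⟩
  X ++ Y                                ∎
  where open ≡-Reasoning

⊑-drop : ∀ {X Y u} → X ++ Y ⊑ u → Y ⊑ suffixFrom (length X) u
⊑-drop {X} {Y} {u} XY⊑u = at-⊑ λ {i} i<∣Y∣ → begin
  at Y i                      ≡⟨ at-++ʳ X Y i ⟨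
  at (X ++ Y) (length X + i)  ≡⟨ ⊑-at XY⊑u (shift i<∣Y∣) ⟩
  u (length X + i)            ∎
  where
  open ≡-Reasoning
  shift : ∀ {i} → i < length Y → length X + i < length (X ++ Y)
  shift {i} i<∣Y∣ = subst (length X + i <_) (sym (length-++ X)) (+-monoʳ-< (length X) i<∣Y∣)

⊑-suffixFrom : ∀ {X u} k → X ⊑ suffixFrom k u → prefixOf u k ++ X ⊑ u
⊑-suffixFrom {X} {u} k X⊑ =
  ⊑-++ (prefixOf-⊑ u k) (subst (λ n → X ⊑ suffixFrom n u) (sym (length-prefixOf u k)) X⊑)

⊑-⊑-IsPrefix : ∀ {X Y u} → X ⊑ u → Y ⊑ u → length X ≤ length Y → IsPrefix X Y
⊑-⊑-IsPrefix {u = u} X⊑u Y⊑u ∣X∣≤∣Y∣ = subst₂ IsPrefix X⊑u Y⊑u (prefixOf-IsPrefix u ∣X∣≤∣Y∣)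

common-prefixes⇒≐ : ∀ {u v} → (∀ i → ∃ λ X → i < length X × X ⊑ u × X ⊑ v) → u ≐ v
common-prefixes⇒≐ common i =
  let X , i<∣X∣ , X⊑u , X⊑v = common i in trans (sym (⊑-at X⊑u i<∣X∣)) (⊑-at X⊑v i<∣X∣)

length-applyW-prefixOf : ∀ {f} → NonErasing f → ∀ u n → n ≤ length (applyW f (prefixOf u n))
length-applyW-prefixOf {f} ne u n =
  subst (_≤ length (applyW f (prefixOf u n))) (length-prefixOf u n) (length-applyW ne (prefixOf u n))

applyW-prefixOf-⊑ : ∀ {f} → NonErasing f → ∀ u n → applyW f (prefixOf u n) ⊑ applyInf f u
applyW-prefixOf-⊑ {f} ne u n = at-⊑ λ {i} i< →
  trans (at-IsPrefix (image-IsPrefix (m≤m+n n (suc i))) i<)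
        (sym (at-IsPrefix (image-IsPrefix (m≤n+m (suc i) n)) (length-applyW-prefixOf ne u (suc i))))
  where
  image-IsPrefix : ∀ {m N} → m ≤ N → IsPrefix (applyW f (prefixOf u m)) (applyW f (prefixOf u N))
  image-IsPrefix = applyW-IsPrefix f ∘ prefixOf-IsPrefix u

applyW-⊑ : ∀ {f X u} → NonErasing f → X ⊑ u → applyW f X ⊑ applyInf f u
applyW-⊑ {f} {X} {u} ne X⊑u =
  subst (λ Y → applyW f Y ⊑ applyInf f u) X⊑u (applyW-prefixOf-⊑ ne u (length X))

≐-applyInf : ∀ {f u y} → NonErasing f → (∀ n → applyW f (prefixOf y n) ⊑ u) → u ≐ applyInf f y
≐-applyInf {f} {y = y} ne prefixes = common-prefixes⇒≐ λ i →
  applyW f (prefixOf y (suc i)) , length-applyW-prefixOf ne y (suc i) , prefixes (suc i) ,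
  applyW-prefixOf-⊑ ne y (suc i)

applyInf-∘ : ∀ {f k} → NonErasing f → NonErasing k → ∀ v →
  applyInf f (applyInf k v) ≐ applyInf (applyW f ∘ k) v
applyInf-∘ {f} {k} nf nk v = ≐-applyInf (NonErasing-∘ nf nk) λ n →
  subst (_⊑ applyInf f (applyInf k v)) (sym (applyW-∘ f k (prefixOf v n)))
    (applyW-⊑ nf (applyW-prefixOf-⊑ nk v n))

applyInf-cong : ∀ {f f′} → (∀ x → f x ≡ f′ x) → ∀ u → applyInf f u ≐ applyInf f′ u
applyInf-cong f≗f′ u i = cong (λ X → at X i) (concatMap-cong f≗f′ (prefixOf u (suc i)))

applyInf-^^-+ : ∀ {f g} → NonErasing f → NonErasing g → ∀ m n y →
  applyInf (applyW g ∘ (f ^^ m)) (applyInf (f ^^ n) y) ≐ applyInf g (applyInf (f ^^ (m + n)) y)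
applyInf-^^-+ {f} {g} nf ng m n y =
  ≐-trans (applyInf-∘ (NonErasing-∘ ng (NonErasing-^^ nf m)) (NonErasing-^^ nf n) y)
  (≐-trans (applyInf-cong composite y)
  (≐-sym (applyInf-∘ ng (NonErasing-^^ nf (m + n)) y)))
  where
  composite : ∀ x → applyW (applyW g ∘ (f ^^ m)) ((f ^^ n) x) ≡ applyW g ((f ^^ (m + n)) x)
  composite x = trans (applyW-∘ g (f ^^ m) ((f ^^ n) x)) (cong (applyW g) (sym (^^-+ f m n x)))

record FinalSegment (v w : InfWord) : Set where
  constructor _,_
  field
    start : ℕ
    suffixFrom-start : suffixFrom start w ≐ v

≐⇒FinalSegment : ∀ {v w} → w ≐ v → FinalSegment v w
≐⇒FinalSegment w≐v = 0 , w≐v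

suffixFrom-FinalSegment : ∀ k w → FinalSegment (suffixFrom k w) w
suffixFrom-FinalSegment k w = k , λ _ → refl

FinalSegment-≐ : ∀ {v v′ w} → v ≐ v′ → FinalSegment v w → FinalSegment v′ w
FinalSegment-≐ v≐v′ (k , e) = k , ≐-trans e v≐v′

FinalSegment-trans : ∀ {u v w} → FinalSegment u v → FinalSegment v w → FinalSegment u w
FinalSegment-trans {w = w} (k , e) (j , e′) =
  j + k , λ i → trans (cong w (+-assoc j k i)) (trans (e′ (k + i)) (e i))

FinalSegment-applyInf : ∀ {f v u} → NonErasing f → FinalSegment v u →
  FinalSegment (applyInf f v) (applyInf f u)
FinalSegment-applyInf {f} {v} {u} ne (k , e) = length (applyW f (prefixOf u k)) , ≐-applyInf ne λ n →
  ⊑-drop (subst (_⊑ applyInf f u) (concatMap-++ f (prefixOf u k) (prefixOf v n))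
    (applyW-⊑ ne (⊑-suffixFrom k (⊑-cong (≐-sym e) (prefixOf-⊑ v n)))))

⊑⇒Factor : ∀ {X w} → X ⊑ w → Factor X w
⊑⇒Factor X⊑w = 0 , X⊑w

Factor-FinalSegment : ∀ {X v w} → FinalSegment v w → Factor X v → Factor X w
Factor-FinalSegment {w = w} (j , e) (k , X⊑) =
  j + k , ⊑-cong (λ i → trans (sym (e (k + i))) (cong w (sym (+-assoc j k i)))) X⊑

Factor-IsPrefix : ∀ {X Y w} → IsPrefix X Y → Factor Y w → Factor X w
Factor-IsPrefix X≼Y (k , Y⊑) = k , ⊑-IsPrefix X≼Y Y⊑

Factor-drop : ∀ {X w} P → Factor (P ++ X) w → Factor X w
Factor-drop {X} {w} P (k , PX⊑) =
  Factor-FinalSegment (suffixFrom-FinalSegment k w) (length P , ⊑-drop {P} {X} PX⊑)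

Factor-snoc : ∀ {X u} → Factor X u → ∃ λ z → Factor (X ++ z ∷ []) u
Factor-snoc {X} {u} (k , X⊑) = suffixFrom (length X) (suffixFrom k u) 0 , k , ⊑-++ {X} X⊑ refl

Factor-applyInf : ∀ {f X u} → NonErasing f → Factor X u → Factor (applyW f X) (applyInf f u)
Factor-applyInf {u = u} ne (k , X⊑) =
  Factor-FinalSegment (FinalSegment-applyInf ne (suffixFrom-FinalSegment k u)) (⊑⇒Factor (applyW-⊑ ne X⊑))

Factor-from-prefixes : ∀ {u w} → (∀ n → ∃ λ X → n ≤ length X × X ⊑ u × Factor X w) →
  ∀ {x} → Factor x u → Factor x w
Factor-from-prefixes {u} {w} prefixes {x} (k , x⊑) =
  let X , k+∣x∣≤∣X∣ , X⊑u , X∈w = prefixes (k + length x)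
      ∣ux∣≡k+∣x∣ = trans (length-++ (prefixOf u k)) (cong (_+ length x) (length-prefixOf u k))
      ux≼X = ⊑-⊑-IsPrefix (⊑-suffixFrom {x} {u} k x⊑) X⊑u
               (subst (_≤ length X) (sym ∣ux∣≡k+∣x∣) k+∣x∣≤∣X∣)
  in Factor-drop {x} {w} (prefixOf u k) (Factor-IsPrefix {w = w} ux≼X X∈w)

Avoids5/2Powers-FinalSegment : ∀ {v w} → FinalSegment v w → Avoids5/2Powers w → Avoids5/2Powers v
Avoids5/2Powers-FinalSegment v⊆w avoid x = avoid x ∘ Factor-FinalSegment v⊆w

-- Periods

HasPeriod? : ∀ W p → Dec (HasPeriod W p)
HasPeriod? W p = (0 <? p) ×-dec map′ unbounded bounded (allUpTo? periodic? (length W))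
  where
  Periodic : ℕ → Set
  Periodic i = i + p < length W → at W i ≡ at W (i + p)
  periodic? : ∀ i → Dec (Periodic i)
  periodic? i = (i + p <? length W) →-dec (at W i Fin.≟ at W (i + p))
  unbounded : (∀ {i} → i < length W → Periodic i) → ∀ i → Periodic i
  unbounded per i i+p< = per (≤-trans (s≤s (m≤m+n i p)) i+p<) i+p<
  bounded : (∀ i → Periodic i) → ∀ {i} → i < length W → Periodic i
  bounded per _ = per _

smallest-period : ∀ W {q} → HasPeriod W q → ∃ (SmallestPeriod W)
smallest-period W = <-rec (λ q → HasPeriod W q → ∃ (SmallestPeriod W)) descend _
  where
  descend : ∀ q → (∀ {m} → m < q → HasPeriod W m → ∃ (SmallestPeriod W)) →
    HasPeriod W q → ∃ (SmallestPeriod W)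
  descend q smaller per with anyUpTo? (HasPeriod? W) q
  ... | yes (m , m<q , per′) = smaller m<q per′
  ... | no none = q , per , λ r per′ → ≮⇒≥ λ r<q → none (r , r<q , per′)

HasPeriod-++ : ∀ P {W} → 0 < length P → IsPrefix W (P ++ W) → HasPeriod (P ++ W) (length P)
HasPeriod-++ P {W} 0<∣P∣ W≼PW = 0<∣P∣ , λ i i+∣P∣<∣PW∣ → begin
  at (P ++ W) i               ≡⟨ at-IsPrefix W≼PW (i<∣W∣ i+∣P∣<∣PW∣) ⟨
  at W i                      ≡⟨ at-++ʳ P W i ⟨
  at (P ++ W) (length P + i)  ≡⟨ cong (at (P ++ W)) (+-comm (length P) i) ⟩
  at (P ++ W) (i + length P)  ∎
  where
  open ≡-Reasoning
  i<∣W∣ : ∀ {i} → i + length P < length (P ++ W) → i < length W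
  i<∣W∣ {i} lt = +-cancelˡ-< (length P) i (length W) (subst₂ _<_ (+-comm i (length P)) (length-++ P) lt)

¬Factor-periodic : ∀ {w W q} → Avoids5/2Powers w → Factor W w → HasPeriod W q → 5 * q ≤ 2 * length W → ⊥
¬Factor-periodic {W = W} {q} avoid W∈w per 5q≤2∣W∣ =
  let p , per-p , least = smallest-period W per
  in avoid W W∈w
       (nonempty W per 5q≤2∣W∣ , p , (per-p , least) , ≤-trans (*-monoʳ-≤ 5 (least q per)) 5q≤2∣W∣)
  where
  nonempty : ∀ W {q} → HasPeriod W q → 5 * q ≤ 2 * length W → NonEmpty W
  nonempty [] (s≤s z≤n , _) ()
  nonempty (x ∷ W) _ _ = x , W , refl

five-halves : ∀ {T T′} → T ≤ 2 * T′ → 5 * T ≤ 2 * (T + (T + T′))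
five-halves {T} {T′} T≤2T′ = begin
  5 * T               ≡⟨ +-comm T (4 * T) ⟩
  4 * T + T           ≤⟨ +-monoʳ-≤ (4 * T) T≤2T′ ⟩
  4 * T + 2 * T′      ≡⟨ distribute T T′ ⟩
  2 * (T + (T + T′))  ∎
  where
  open ≤-Reasoning
  distribute : ∀ T T′ → 4 * T + 2 * T′ ≡ 2 * (T + (T + T′))
  distribute = solve-∀

¬Factor-ttt′ : ∀ {w t t′} → Avoids5/2Powers w → 0 < length t → IsPrefix t′ t → length t ≤ 2 * length t′ →
  ¬ Factor (t ++ t ++ t′) w
¬Factor-ttt′ {w} {t} {t′} avoid 0<∣t∣ t′≼t ∣t∣≤2∣t′∣ ttt′∈w =
  ¬Factor-periodic {w} avoid ttt′∈w (HasPeriod-++ t 0<∣t∣ tt′≼ttt′)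
    (subst (λ n → 5 * length t ≤ 2 * n) (sym ∣ttt′∣) (five-halves ∣t∣≤2∣t′∣))
  where
  tt′≼ttt′ : IsPrefix (t ++ t′) (t ++ t ++ t′)
  tt′≼ttt′ = IsPrefix-trans (IsPrefix-++ˡ t t′≼t) (t′ , ++-assoc t t t′)
  ∣ttt′∣ : length (t ++ t ++ t′) ≡ length t + (length t + length t′)
  ∣ttt′∣ = trans (length-++ t) (cong (length t +_) (length-++ t))

¬Factor-cbb : ∀ {w b c s} → Avoids5/2Powers w → 0 < length b → IsSuffix s b → IsSuffix s c →
  length b ≤ 2 * length s → ¬ Factor (c ++ b ++ b) w
¬Factor-cbb {w} {s = s} avoid 0<∣b∣ (y , refl) (z , refl) ∣b∣≤2∣s∣ cbb∈w =
  ¬Factor-ttt′ {w} {s ++ y} {s} avoid (subst (0 <_) ∣ys∣≡∣sy∣ 0<∣b∣) (y , refl)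
    (subst (_≤ 2 * length s) ∣ys∣≡∣sy∣ ∣b∣≤2∣s∣)
    (Factor-drop {w = w} z (subst (λ W → Factor W w) regroup cbb∈w))
  where
  ∣ys∣≡∣sy∣ : length (y ++ s) ≡ length (s ++ y)
  ∣ys∣≡∣sy∣ = length-++-comm y s
  regroup : (z ++ s) ++ (y ++ s) ++ (y ++ s) ≡ z ++ (s ++ y) ++ (s ++ y) ++ s
  regroup = solve (++-monoid Letter)

¬Factor-ababa : ∀ {w a b} → Avoids5/2Powers w → 0 < length a → length b ≤ length a →
  ¬ Factor (a ++ b ++ a ++ b ++ a) w
¬Factor-ababa {w} {a} {b} avoid 0<∣a∣ ∣b∣≤∣a∣ ababa∈w =
  ¬Factor-ttt′ {w} {a ++ b} {a} avoid (<-≤-trans 0<∣a∣ (length-++-≤ˡ a)) (b , refl) ∣ab∣≤2∣a∣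
    (subst (λ W → Factor W w) regroup ababa∈w)
  where
  regroup : a ++ b ++ a ++ b ++ a ≡ (a ++ b) ++ (a ++ b) ++ a
  regroup = solve (++-monoid Letter)
  ∣ab∣≤2∣a∣ : length (a ++ b) ≤ 2 * length a
  ∣ab∣≤2∣a∣ = begin
    length (a ++ b)        ≡⟨ length-++ a ⟩
    length a + length b    ≤⟨ +-monoʳ-≤ (length a) ∣b∣≤∣a∣ ⟩
    length a + length a    ≡⟨ cong (length a +_) (+-identityʳ (length a)) ⟨
    2 * length a           ∎
    where open ≤-Reasoning

-- Admissible morphisms

record Admissible (a b c : Word) : Set where
  field
    nonempty-a : NonEmpty a
    nonempty-b : NonEmpty b
    nonempty-c : NonEmpty c
    b≼a : IsPrefix b a
    a≼c : IsPrefix a c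
    ∣c∣≤2∣b∣ : length c ≤ 2 * length b
    s : Word
    s≽b : IsSuffix s b
    s≽c : IsSuffix s c
    ∣b∣≤2∣s∣ : length b ≤ 2 * length s

  g : Morphism
  g = [ a , b , c ]

  ∣b∣≤∣a∣ : length b ≤ length a
  ∣b∣≤∣a∣ = IsPrefix-length b≼a

  ∣a∣≤∣c∣ : length a ≤ length c
  ∣a∣≤∣c∣ = IsPrefix-length a≼c

  g-nonErasing : NonErasing g
  g-nonErasing = nonErasing λ where
    zero → NonEmpty⇒0<length nonempty-a
    (suc zero) → NonEmpty⇒0<length nonempty-b
    (suc (suc zero)) → NonEmpty⇒0<length nonempty-c

  b≼g : ∀ x → IsPrefix b (g x)
  b≼g zero = b≼a
  b≼g (suc zero) = IsPrefix-refl b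
  b≼g (suc (suc zero)) = IsPrefix-trans b≼a a≼c

  ∣g∣≤2∣b∣ : ∀ x → length (g x) ≤ 2 * length b
  ∣g∣≤2∣b∣ zero = ≤-trans ∣a∣≤∣c∣ ∣c∣≤2∣b∣
  ∣g∣≤2∣b∣ (suc zero) = m≤m+n (length b) _
  ∣g∣≤2∣b∣ (suc (suc zero)) = ∣c∣≤2∣b∣

Admissible-conjugate : ∀ {a b c} → Admissible a b c → Admissible (c ++ a ++ b) (c ++ a) (c ++ a ++ b ++ a)
Admissible-conjugate {a} {b} {c} adm = record
  { nonempty-a = NonEmpty-++ (a ++ b) nonempty-c
  ; nonempty-b = NonEmpty-++ a nonempty-c
  ; nonempty-c = NonEmpty-++ (a ++ b ++ a) nonempty-c
  ; b≼a = b , ++-assoc c a b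
  ; a≼c = a , solve (++-monoid Letter)
  ; ∣c∣≤2∣b∣ = ∣caba∣≤2∣ca∣
  ; s = s ++ a
  ; s≽b = IsSuffix-++ [] a s≽c
  ; s≽c = subst (IsSuffix (s ++ a)) (++-assoc c a (b ++ a)) (IsSuffix-++ (c ++ a) a s≽b)
  ; ∣b∣≤2∣s∣ = ∣ca∣≤2∣sa∣
  }
  where
  open Admissible adm
  A = length a
  B = length b
  C = length c
  S = length s
  ∣caba∣≤2∣ca∣ : length (c ++ a ++ b ++ a) ≤ 2 * length (c ++ a)
  ∣caba∣≤2∣ca∣ rewrite length-++ c {a ++ b ++ a} | length-++ a {b ++ a} | length-++ b {a} | length-++ c {a} =
    begin
      C + (A + (B + A))  ≤⟨ +-monoʳ-≤ C (+-monoʳ-≤ A (+-monoˡ-≤ A (≤-trans ∣b∣≤∣a∣ ∣a∣≤∣c∣))) ⟩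
      C + (A + (C + A))  ≡⟨ regroup C A ⟩
      2 * (C + A)        ∎
    where
    open ≤-Reasoning
    regroup : ∀ C A → C + (A + (C + A)) ≡ 2 * (C + A)
    regroup = solve-∀
  ∣ca∣≤2∣sa∣ : length (c ++ a) ≤ 2 * length (s ++ a)
  ∣ca∣≤2∣sa∣ rewrite length-++ c {a} | length-++ s {a} =
    begin
      C + A          ≤⟨ +-monoˡ-≤ A ∣c∣≤2∣b∣ ⟩
      2 * B + A      ≡⟨ regroup₁ B A ⟩
      B + B + A      ≤⟨ +-monoˡ-≤ A (+-mono-≤ ∣b∣≤2∣s∣ ∣b∣≤∣a∣) ⟩
      2 * S + A + A  ≡⟨ regroup₂ S A ⟩
      2 * (S + A)    ∎
    where
    open ≤-Reasoning
    regroup₁ : ∀ B A → 2 * B + A ≡ B + B + A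
    regroup₁ = solve-∀
    regroup₂ : ∀ S A → 2 * S + A + A ≡ 2 * (S + A)
    regroup₂ = solve-∀

record Avoids-xx-21-0101 (y : InfWord) : Set where
  field
    no-xx : ∀ {x} → ¬ Factor (x ∷ x ∷ []) y
    no-21 : ¬ Factor (2' ∷ 1' ∷ []) y
    no-0101 : ¬ Factor (0' ∷ 1' ∷ 0' ∷ 1' ∷ []) y

suffixFrom-avoids-xx-21-0101 : ∀ {y} k → Avoids-xx-21-0101 y → Avoids-xx-21-0101 (suffixFrom k y)
suffixFrom-avoids-xx-21-0101 {y} k clean = record
  { no-xx = no-xx ∘ in-y
  ; no-21 = no-21 ∘ in-y
  ; no-0101 = no-0101 ∘ in-y
  }
  where
  open Avoids-xx-21-0101 clean
  in-y : ∀ {X} → Factor X (suffixFrom k y) → Factor X y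
  in-y = Factor-FinalSegment (suffixFrom-FinalSegment k y)

preimage-avoids-xx-21-0101 : ∀ {a b c w u} → Admissible a b c → Avoids5/2Powers w →
  w ≐ applyInf [ a , b , c ] u → Avoids-xx-21-0101 u
preimage-avoids-xx-21-0101 {a} {b} {c} {w} {u} adm avoid w≐gu = record
  { no-xx = no-xx
  ; no-21 = no-21
  ; no-0101 = no-0101
  }
  where
  open Admissible adm
  0<∣a∣ = NonEmpty⇒0<length nonempty-a
  image-Factor : ∀ {X} → Factor X u → Factor (applyW g X) w
  image-Factor = Factor-FinalSegment (≐⇒FinalSegment w≐gu) ∘ Factor-applyInf {u = u} g-nonErasing
  no-xx : ∀ {x} → ¬ Factor (x ∷ x ∷ []) u
  no-xx {x} xx∈u with Factor-snoc {u = u} xx∈u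
  ... | z , xxz∈u = ¬Factor-ttt′ {w} {g x} {b} avoid (nonEmpty-image g-nonErasing x) (b≼g x) (∣g∣≤2∣b∣ x)
    (Factor-IsPrefix {w = w} (IsPrefix-++ˡ (g x) (IsPrefix-++ˡ (g x) (IsPrefix-++ʳ [] (b≼g z))))
      (image-Factor xxz∈u))
  no-21 : ¬ Factor (2' ∷ 1' ∷ []) u
  no-21 21∈u with Factor-snoc {u = u} 21∈u
  ... | z , 21z∈u = ¬Factor-cbb {w} {b} {c} avoid (NonEmpty⇒0<length nonempty-b) s≽b s≽c ∣b∣≤2∣s∣
    (Factor-IsPrefix {w = w} (IsPrefix-++ˡ c (IsPrefix-++ˡ b (IsPrefix-++ʳ [] (b≼g z)))) (image-Factor 21z∈u))
  ababa∈w : ∀ {z} → IsPrefix a (g z) → Factor (0' ∷ 1' ∷ 0' ∷ 1' ∷ z ∷ []) u → Factor (a ++ b ++ a ++ b ++ a) w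
  ababa∈w a≼gz 0101z∈u = Factor-IsPrefix {w = w}
    (IsPrefix-++ˡ a (IsPrefix-++ˡ b (IsPrefix-++ˡ a (IsPrefix-++ˡ b (IsPrefix-++ʳ [] a≼gz)))))
    (image-Factor 0101z∈u)
  no-0101 : ¬ Factor (0' ∷ 1' ∷ 0' ∷ 1' ∷ []) u
  no-0101 0101∈u with Factor-snoc {u = u} 0101∈u
  ... | zero , 01010∈u = ¬Factor-ababa {w} {a} {b} avoid 0<∣a∣ ∣b∣≤∣a∣ (ababa∈w (IsPrefix-refl a) 01010∈u)
  ... | suc zero , 01011∈u = no-xx (Factor-drop {w = u} (0' ∷ 1' ∷ 0' ∷ []) 01011∈u)
  ... | suc (suc zero) , 01012∈u = ¬Factor-ababa {w} {a} {b} avoid 0<∣a∣ ∣b∣≤∣a∣ (ababa∈w a≼c 01012∈u)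

-- Desubstitution

module Desubstitution {f : Morphism} (f-nonErasing : NonErasing f) (P : InfWord → Set)
  (block : ∀ {y} → P y → Σ Letter λ x → f x ⊑ y × P (suffixFrom (length (f x)) y)) where

  private
    next : ∀ {y} (Py : P y) → P (suffixFrom (length (f (proj₁ (block Py)))) y)
    next Py = proj₂ (proj₂ (block Py))

    letters : ∀ {y} → P y → InfWord
    letters Py zero = proj₁ (block Py)
    letters Py (suc n) = letters (next Py) n

    applyW-letters-⊑ : ∀ {y} (Py : P y) n → applyW f (prefixOf (letters Py) n) ⊑ y
    applyW-letters-⊑ Py zero = refl
    applyW-letters-⊑ Py (suc n) = ⊑-++ (proj₁ (proj₂ (block Py))) (applyW-letters-⊑ (next Py) n)

  desubstitute : ∀ {y} → P y → ∃ λ v → y ≐ applyInf f v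
  desubstitute Py = letters Py , ≐-applyInf f-nonErasing (applyW-letters-⊑ Py)

pair-cong : ∀ {p q p′ q′ : Letter} → p ≡ p′ → q ≡ q′ → p ∷ q ∷ [] ≡ p′ ∷ q′ ∷ []
pair-cong = cong₂ (λ p q → p ∷ q ∷ [])

module _ {y : InfWord} (clean : Avoids-xx-21-0101 y) where
  open Avoids-xx-21-0101 clean

  after-2 : y 0 ≡ 2' → y 1 ≡ 0'
  after-2 y₀≡2 with y 1 in y₁≡
  ... | zero = refl
  ... | suc zero = ⊥-elim (no-21 (0 , pair-cong y₀≡2 y₁≡))
  ... | suc (suc zero) = ⊥-elim (no-xx (0 , pair-cong y₀≡2 y₁≡))

AtBlockStart : InfWord → Set
AtBlockStart y = Avoids-xx-21-0101 y × y 0 ≡ 0'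

module _ {y : InfWord} (clean : Avoids-xx-21-0101 y) where
  open Avoids-xx-21-0101 clean

  private
    tail : ∀ k → Avoids-xx-21-0101 (suffixFrom k y)
    tail k = suffixFrom-avoids-xx-21-0101 k clean

  -- Each block γ²(x) is read from its initial 0 up to the next 2.
  γ²-block : y 0 ≡ 0' → Σ Letter λ x → (γ ^^ 2) x ⊑ y × AtBlockStart (suffixFrom (length ((γ ^^ 2) x)) y)
  γ²-block y₀≡0 with y 1 in y₁≡
  ... | zero = ⊥-elim (no-xx (0 , pair-cong y₀≡0 y₁≡))
  ... | suc (suc zero) = 1' , pair-cong y₀≡0 y₁≡ , tail 2 , after-2 (tail 1) y₁≡
  ... | suc zero with y 2 in y₂≡
  ...   | suc zero = ⊥-elim (no-xx (1 , pair-cong y₁≡ y₂≡))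
  ...   | suc (suc zero) = 0' , cong₂ _∷_ y₀≡0 (pair-cong y₁≡ y₂≡) , tail 3 , after-2 (tail 2) y₂≡
  ...   | zero with y 3 in y₃≡
  ...     | zero = ⊥-elim (no-xx (2 , pair-cong y₂≡ y₃≡))
  ...     | suc zero = ⊥-elim (no-0101 (0 , y₀₋₃≡0101))
    where y₀₋₃≡0101 = cong₂ _∷_ y₀≡0 (cong₂ _∷_ y₁≡ (pair-cong y₂≡ y₃≡))
  ...     | suc (suc zero) = 2' , y₀₋₃≡0102 , tail 4 , after-2 (tail 3) y₃≡
    where y₀₋₃≡0102 = cong₂ _∷_ y₀≡0 (cong₂ _∷_ y₁≡ (pair-cong y₂≡ y₃≡))

  reaches-block-start : ∃ λ k → AtBlockStart (suffixFrom k y)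
  reaches-block-start with y 0 in y₀≡
  ... | zero = 0 , clean , y₀≡
  ... | suc (suc zero) = 1 , tail 1 , after-2 clean y₀≡
  ... | suc zero with y 1 in y₁≡
  ...   | zero = 1 , tail 1 , y₁≡
  ...   | suc zero = ⊥-elim (no-xx (0 , pair-cong y₀≡ y₁≡))
  ...   | suc (suc zero) = 2 , tail 2 , after-2 (tail 1) y₁≡

γ-nonErasing : NonErasing γ
γ-nonErasing = nonErasing λ where
  zero → s≤s z≤n
  (suc zero) → s≤s z≤n
  (suc (suc zero)) → s≤s z≤n

γ²-desubstitution : ∀ {y} → Avoids-xx-21-0101 y → ∃ λ v → FinalSegment (applyInf (γ ^^ 2) v) y
γ²-desubstitution clean =
  let k , start = reaches-block-start clean
      v , suffix≐ = desubstitute start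
  in v , (k , suffix≐)
  where
  open Desubstitution (NonErasing-^^ γ-nonErasing 2) AtBlockStart (λ (clean , y₀≡0) → γ²-block clean y₀≡0)

-- Conjugation

module Conjugation {f h p : Morphism} {c : Word} (0<∣c∣ : 0 < length c)
  (f≡pc : ∀ x → f x ≡ p x ++ c) (h≡cp : ∀ x → h x ≡ c ++ p x) where

  f-nonErasing : NonErasing f
  f-nonErasing = nonErasing λ x →
    subst (λ X → 0 < length X) (sym (f≡pc x)) (<-≤-trans 0<∣c∣ (length-++-≤ʳ c {p x}))

  h-nonErasing : NonErasing h
  h-nonErasing = nonErasing λ x →
    subst (λ X → 0 < length X) (sym (h≡cp x)) (<-≤-trans 0<∣c∣ (length-++-≤ˡ c))

  applyW-conjugate : ∀ X → c ++ applyW f X ≡ applyW h X ++ c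
  applyW-conjugate [] = ++-identityʳ c
  applyW-conjugate (x ∷ X) = begin
    c ++ f x ++ applyW f X          ≡⟨ cong (λ Y → c ++ Y ++ applyW f X) (f≡pc x) ⟩
    c ++ (p x ++ c) ++ applyW f X   ≡⟨ solve (++-monoid Letter) ⟩
    (c ++ p x) ++ c ++ applyW f X   ≡⟨ cong₂ _++_ (sym (h≡cp x)) (applyW-conjugate X) ⟩
    h x ++ applyW h X ++ c          ≡⟨ ++-assoc (h x) (applyW h X) c ⟨
    (h x ++ applyW h X) ++ c        ∎
    where open ≡-Reasoning

  h-FinalSegment-f : ∀ y → FinalSegment (applyInf f y) (applyInf h y)
  h-FinalSegment-f y = length c , ≐-applyInf f-nonErasing λ n →
    ⊑-drop {c} (subst (_⊑ applyInf h y) (sym (applyW-conjugate (prefixOf y n)))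
      (⊑-IsPrefix (IsPrefix-applyW-prefixOf-suc c≼h y n) (applyW-prefixOf-⊑ h-nonErasing y (suc n))))
    where
    c≼h : ∀ x → IsPrefix c (h x)
    c≼h x = p x , sym (h≡cp x)

  f-FinalSegment-h : ∀ y → FinalSegment (applyInf h (y ∘ suc)) (applyInf f y)
  f-FinalSegment-h y = length (p (y 0)) , ≐-applyInf h-nonErasing λ n →
    ⊑-drop {p (y 0)} (⊑-IsPrefix (IsPrefix-++ˡ (p (y 0)) (c , refl))
      (subst (_⊑ applyInf f y) (f-image n) (applyW-prefixOf-⊑ f-nonErasing y (suc n))))
    where
    f-image : ∀ n → applyW f (prefixOf y (suc n)) ≡ p (y 0) ++ applyW h (prefixOf (y ∘ suc) n) ++ c
    f-image n = begin
      f (y 0) ++ applyW f Y          ≡⟨ cong (_++ applyW f Y) (f≡pc (y 0)) ⟩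
      (p (y 0) ++ c) ++ applyW f Y   ≡⟨ ++-assoc (p (y 0)) c (applyW f Y) ⟩
      p (y 0) ++ c ++ applyW f Y     ≡⟨ cong (p (y 0) ++_) (applyW-conjugate Y) ⟩
      p (y 0) ++ applyW h Y ++ c     ∎
      where
      open ≡-Reasoning
      Y = prefixOf (y ∘ suc) n

module _ {a b c : Word} (adm : Admissible a b c) where
  open Admissible adm

  gγ²≡pc : ∀ x → applyW g ((γ ^^ 2) x) ≡ [ a ++ b , a , a ++ b ++ a ] x ++ c
  gγ²≡pc zero = solve (++-monoid Letter)
  gγ²≡pc (suc zero) = solve (++-monoid Letter)
  gγ²≡pc (suc (suc zero)) = solve (++-monoid Letter)

  h≡cp : ∀ x → [ c ++ a ++ b , c ++ a , c ++ a ++ b ++ a ] x ≡ c ++ [ a ++ b , a , a ++ b ++ a ] x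
  h≡cp zero = refl
  h≡cp (suc zero) = refl
  h≡cp (suc (suc zero)) = refl

  open Conjugation {applyW g ∘ (γ ^^ 2)} {[ c ++ a ++ b , c ++ a , c ++ a ++ b ++ a ]} {[ a ++ b , a , a ++ b ++ a ]}
    (NonEmpty⇒0<length nonempty-c) gγ²≡pc h≡cp public

conjugate-FinalSegment : ∀ {a b c w u} → Admissible a b c → Avoids5/2Powers w → w ≐ applyInf [ a , b , c ] u →
  ∃ λ v → FinalSegment (applyInf [ c ++ a ++ b , c ++ a , c ++ a ++ b ++ a ] v) w
conjugate-FinalSegment {w = w} {u} adm avoid w≐gu
  with γ²-desubstitution (preimage-avoids-xx-21-0101 {u = u} adm avoid w≐gu)
... | v , γ²v⊆u = v ∘ suc , FinalSegment-trans (f-FinalSegment-h adm v) (FinalSegment-trans gγ²v⊆gu gu⊆w)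
  where
  open Admissible adm
  gu⊆w : FinalSegment (applyInf g u) w
  gu⊆w = ≐⇒FinalSegment w≐gu
  gγ²v⊆gu : FinalSegment (applyInf (applyW g ∘ (γ ^^ 2)) v) (applyInf g u)
  gγ²v⊆gu = FinalSegment-≐ (applyInf-∘ g-nonErasing (NonErasing-^^ γ-nonErasing 2) v)
              (FinalSegment-applyInf g-nonErasing γ²v⊆u)

final-segments : ∀ n {a b c w u} → Admissible a b c → Avoids5/2Powers w → w ≐ applyInf [ a , b , c ] u →
  ∃ λ v → FinalSegment (applyInf [ a , b , c ] (applyInf (γ ^^ (2 * n)) v)) w
final-segments zero {u = u} adm _ w≐gu = u , ≐⇒FinalSegment (≐-trans w≐gu (≐-sym gγ⁰u≐gu))
  where
  open Admissible adm
  gγ⁰u≐gu : applyInf g (applyInf (γ ^^ 0) u) ≐ applyInf g u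
  gγ⁰u≐gu = ≐-trans (applyInf-∘ g-nonErasing (NonErasing-^^ γ-nonErasing 0) u)
                    (applyInf-cong (λ x → ++-identityʳ (g x)) u)
final-segments (suc n) {u = u} adm avoid w≐gu with conjugate-FinalSegment {u = u} adm avoid w≐gu
... | v , hv⊆w
  with final-segments n {u = v} (Admissible-conjugate adm) (Avoids5/2Powers-FinalSegment hv⊆w avoid) (λ _ → refl)
...   | y , hγ²ⁿy⊆hv =
  y , FinalSegment-trans (FinalSegment-≐ gγ²γ²ⁿy≐ (h-FinalSegment-f adm γ²ⁿy))
        (FinalSegment-trans hγ²ⁿy⊆hv hv⊆w)
  where
  open Admissible adm
  γ²ⁿy = applyInf (γ ^^ (2 * n)) y
  gγ²γ²ⁿy≐ : applyInf (applyW g ∘ (γ ^^ 2)) γ²ⁿy ≐ applyInf g (applyInf (γ ^^ (2 * suc n)) y)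
  gγ²γ²ⁿy≐ = subst (λ e → applyInf (applyW g ∘ (γ ^^ 2)) γ²ⁿy ≐ applyInf g (applyInf (γ ^^ e) y))
               (sym (*-suc 2 n)) (applyInf-^^-+ γ-nonErasing g-nonErasing 2 (2 * n) y)

-- Prefixes of G

γ^^-0≡0∷t : ∀ j → ∃ λ t → (γ ^^ j) 0' ≡ 0' ∷ t × j ≤ length t
γ^^-0≡0∷t zero = [] , refl , z≤n
γ^^-0≡0∷t (suc j) with γ^^-0≡0∷t j
... | t , γʲ0≡0t , j≤∣t∣ =
  1' ∷ applyW γ t , cong (applyW γ) γʲ0≡0t , s≤s (≤-trans j≤∣t∣ (length-applyW γ-nonErasing t))

length-γ^^-0 : ∀ j → j < length ((γ ^^ j) 0')
length-γ^^-0 j =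
  let t , γʲ0≡0t , j≤∣t∣ = γ^^-0≡0∷t j in subst (λ X → j < length X) (sym γʲ0≡0t) (s≤s j≤∣t∣)

γ²-head : ∀ x → ∃ λ t → (γ ^^ 2) x ≡ 0' ∷ t
γ²-head zero = _ , refl
γ²-head (suc zero) = _ , refl
γ²-head (suc (suc zero)) = _ , refl

γ^^-0-IsPrefix : ∀ j {d x t} → (γ ^^ d) x ≡ 0' ∷ t → IsPrefix ((γ ^^ j) 0') ((γ ^^ (j + d)) x)
γ^^-0-IsPrefix j {d} {x} {t} γᵈx≡0t =
  applyW (γ ^^ j) t , sym (trans (^^-+ γ j d x) (cong (applyW (γ ^^ j)) γᵈx≡0t))

γ^^-0-⊑-G : ∀ j → (γ ^^ j) 0' ⊑ G
γ^^-0-⊑-G j = at-⊑ λ {i} i<∣γʲ0∣ → begin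
  at ((γ ^^ j) 0') i            ≡⟨ at-IsPrefix (γ^^-0-≼ j (suc i)) i<∣γʲ0∣ ⟩
  at ((γ ^^ (j + suc i)) 0') i  ≡⟨ cong (λ e → at ((γ ^^ e) 0') i) (+-comm j (suc i)) ⟩
  at ((γ ^^ (suc i + j)) 0') i  ≡⟨ at-IsPrefix (γ^^-0-≼ (suc i) j) (<-trans (n<1+n i) (length-γ^^-0 (suc i))) ⟨
  at ((γ ^^ suc i) 0') i        ∎
  where
  open ≡-Reasoning
  γ^^-0-≼ : ∀ j d → IsPrefix ((γ ^^ j) 0') ((γ ^^ (j + d)) 0')
  γ^^-0-≼ j d = γ^^-0-IsPrefix j (proj₁ (proj₂ (γ^^-0≡0∷t d)))

γ^^-0-⊑-γ^^ : ∀ j v → (γ ^^ j) 0' ⊑ applyInf (γ ^^ (j + 2)) v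
γ^^-0-⊑-γ^^ j v = ⊑-IsPrefix (IsPrefix-++ʳ [] (γ^^-0-IsPrefix j (proj₂ (γ²-head (v 0)))))
                    (applyW-prefixOf-⊑ (NonErasing-^^ γ-nonErasing (j + 2)) v 1)

Factor-image-G⇒Factor : ∀ {a b c w} → Admissible a b c →
  (∀ n → ∃ λ v → FinalSegment (applyInf [ a , b , c ] (applyInf (γ ^^ (2 * suc n)) v)) w) →
  ∀ {x} → Factor x (applyInf [ a , b , c ] G) → Factor x w
Factor-image-G⇒Factor {a} {b} {c} {w} adm segments = Factor-from-prefixes {applyInf g G} {w} λ n →
  let v , gγ²⁽ⁿ⁺¹⁾v⊆w = segments n
  in applyW g ((γ ^^ (2 * n)) 0')
   , ≤-trans (m≤n*m n 2) (≤-trans (<⇒≤ (length-γ^^-0 (2 * n))) (length-applyW g-nonErasing ((γ ^^ (2 * n)) 0')))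
   , applyW-⊑ g-nonErasing (γ^^-0-⊑-G (2 * n))
   , Factor-FinalSegment gγ²⁽ⁿ⁺¹⁾v⊆w
       (⊑⇒Factor {w = applyInf g (applyInf (γ ^^ (2 * suc n)) v)} (applyW-⊑ g-nonErasing (γ²ⁿ0⊑γ²ⁿ⁺² n v)))
  where
  open Admissible adm
  γ²ⁿ0⊑γ²ⁿ⁺² : ∀ n v → (γ ^^ (2 * n)) 0' ⊑ applyInf (γ ^^ (2 * suc n)) v
  γ²ⁿ0⊑γ²ⁿ⁺² n v = subst (λ e → (γ ^^ (2 * n)) 0' ⊑ applyInf (γ ^^ e) v)
    (trans (+-comm (2 * n) 2) (sym (*-suc 2 n))) (γ^^-0-⊑-γ^^ (2 * n) v)

corollary1 : (w u : InfWord) (a b c : Word) →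
    Avoids5/2Powers w →
    NonEmpty a → NonEmpty b → NonEmpty c →
    w ≐ applyInf [ a , b , c ] u →
    IsPrefix b a → IsPrefix a c →
    length c ≤ 2 * length b →
    (∃ λ s → IsSuffix s b × IsSuffix s c × length b ≤ 2 * length s) →
    (∀ (n : ℕ) → ∃ λ k → ∃ λ v →
        suffixFrom k w ≐ applyInf [ a , b , c ] (applyInf (γ ^^ (2 * suc n)) v))
    × (∀ x → Factor x (applyInf [ a , b , c ] G) → Factor x w)
corollary1 w u a b c avoid nonempty-a nonempty-b nonempty-c w≐gu b≼a a≼c ∣c∣≤2∣b∣
           (s , s≽b , s≽c , ∣b∣≤2∣s∣) =
  (λ n → let v , (k , e) = segments n in k , v , e) , λ x → Factor-image-G⇒Factor adm segments
  where
  adm : Admissible a b c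
  adm = record
    { nonempty-a = nonempty-a ; nonempty-b = nonempty-b ; nonempty-c = nonempty-c
    ; b≼a = b≼a ; a≼c = a≼c ; ∣c∣≤2∣b∣ = ∣c∣≤2∣b∣
    ; s = s ; s≽b = s≽b ; s≽c = s≽c ; ∣b∣≤2∣s∣ = ∣b∣≤2∣s∣
    }
  segments : ∀ n → ∃ λ v → FinalSegment (applyInf [ a , b , c ] (applyInf (γ ^^ (2 * suc n)) v)) w
  segments n = final-segments (suc n) {u = u} adm avoid w≐gu
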